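{- Let $([0,\tau],\le,+)$ satisfy Axioms 1–9 listed in the context. If $y,z\in[0,\tau]$ with $0\le y\le z<\tau$, then $\tau\dot{ - }z\le \tau\dot{ - }y$.
   Context: $([0,\tau],\le)$ is a linearly ordered set with least element $0$ and greatest element $\tau$, with a binary operation $+$ satisfying (variables over $[0,\tau]$, universally quantified): 1. $x+y=y+x$. 2. $x+0=x$. 3. $x+\tau=\tau$. 4. If $x_1\le y_1$ and $x_2\le y_2$ then $x_1+x_2\le y_1+y_2$. 5. $x+(y+z)=(x+y)+z$. 6. If $x+y=x+z<\tau$ then $y=z$. 7. If $x\le y<\tau$ there is a unique $z$ with $x+z=y$, denoted $y\dot{ - }x$. 8. For each $x$ there is some $z$ with $x+z=\tau$, and among all such $z$ there is a least one, denoted $\tau\dot{ - }x$. 9. $\tau\dot{ - }(\tau\dot{ - }x)=x$. -}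

module Defs where

open import Level using (Level; _⊔_; suc)
open import Relation.Binary.PropositionalEquality using (_≡_)
open import Data.Product using (Σ; _×_; ∃)
open import Data.Sum using (_⊎_)
open import Relation.Nullary using (¬_)

record TauStructure (a ℓ : Level) : Set (suc (a ⊔ ℓ)) where
  infix 4 _≤_ _<_
  infixl 6 _+_
  field
    Carrier : Set a
    _≤_     : Carrier → Carrier → Set ℓ
    ≤-refl    : ∀ {x} → x ≤ x
    ≤-trans   : ∀ {x y z} → x ≤ y → y ≤ z → x ≤ z
    ≤-antisym : ∀ {x y} → x ≤ y → y ≤ x → x ≡ y
    ≤-total   : ∀ x y → x ≤ y ⊎ y ≤ x
    𝟘 : Carrier
    τ : Carrier
    𝟘-least    : ∀ x → 𝟘 ≤ x
    τ-greatest : ∀ x → x ≤ τ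
    _+_ : Carrier → Carrier → Carrier

  _<_ : Carrier → Carrier → Set (a ⊔ ℓ)
  x < y = (x ≤ y) × ¬ (x ≡ y)

  field
    +-comm : ∀ x y → x + y ≡ y + x
    +-identityʳ : ∀ x → x + 𝟘 ≡ x
    +-τ : ∀ x → x + τ ≡ τ
    +-mono-≤ : ∀ {x₁ y₁ x₂ y₂} → x₁ ≤ y₁ → x₂ ≤ y₂ → x₁ + x₂ ≤ y₁ + y₂
    +-assoc : ∀ x y z → x + (y + z) ≡ (x + y) + z
    +-cancel : ∀ x y z → x + y ≡ x + z → x + y < τ → y ≡ z
    ∸-exists : ∀ x y → x ≤ y → y < τ → Σ Carrier (λ z → x + z ≡ y)
    ∸-unique : ∀ x y z z′ → x ≤ y → y < τ → x + z ≡ y → x + z′ ≡ y → z ≡ z′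
    τ∸_ : Carrier → Carrier
    τ∸-spec  : ∀ x → x + (τ∸ x) ≡ τ
    τ∸-least : ∀ x z → x + z ≡ τ → (τ∸ x) ≤ z
    τ∸-invol : ∀ x → τ∸ (τ∸ x) ≡ x

-- Proof idea: for y ≤ z, monotonicity of + (Axiom 4) gives
--   τ = y + (τ ∸ y) ≤ z + (τ ∸ y),
-- and since τ is the greatest element this forces z + (τ ∸ y) = τ.
-- So τ ∸ y is one of the complements of z, and τ ∸ z, being the least
-- complement of z (Axiom 8), lies below it.
--
-- The argument holds for all y ≤ z.
module Submission where

open import Defs
open import Relation.Binary.PropositionalEquality using (_≡_; subst)

module TauStructureProperties {a ℓ} (S : TauStructure a ℓ) where
  open TauStructure S

  τ≤⇒≡τ : ∀ {w} → τ ≤ w → w ≡ τ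
  τ≤⇒≡τ τ≤w = ≤-antisym (τ-greatest _) τ≤w

  complement-mono : ∀ {y z c} → y ≤ z → y + c ≡ τ → z + c ≡ τ
  complement-mono {y} {z} {c} y≤z y+c≡τ =
    τ≤⇒≡τ (subst (_≤ z + c) y+c≡τ (+-mono-≤ y≤z ≤-refl))

  τ∸-antitone : ∀ {y z} → y ≤ z → (τ∸ z) ≤ (τ∸ y)
  τ∸-antitone {y} {z} y≤z =
    τ∸-least z (τ∸ y) (complement-mono y≤z (τ∸-spec y))

lemma1 : ∀ {a ℓ} (S : TauStructure a ℓ) → let open TauStructure S in
    ∀ (y z : Carrier) → 𝟘 ≤ y → y ≤ z → z < τ → (τ∸ z) ≤ (τ∸ y)
lemma1 S y z _ y≤z _ = τ∸-antitone y≤z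
  where open TauStructureProperties S
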